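{- There is a polynomial $p(s,n,m)$ such that for all integers $n,m,s\ge 1$ and every satisfiable CNF formula $F$ with $n$ variables and $m$ clauses, there exists a Resolution refutation of $\mathrm{RREF}(F,s)$ of length at most $p(s,n,m)$. In fact, $p(s,n,m)\in O((snm)^2)$.
   Context: Resolution: a clause is a set of literals (variables $X$ or negations $\bar X$), non-tautological if it does not contain both $X$ and $\bar X$; a CNF is a set of clauses. $D$ is a weakening of $C$ if $C\subseteq D$; if $X\in C$, $\bar X\in D$, the resolvent on $X$ is $(C\setminus\{X\})\cup(D\setminus\{\bar X\})$. A Resolution refutation of a CNF $G$ is a sequence $(D_1,\dots,D_\ell)$ of non-tautological clauses with $D_\ell=\emptyset$, each $D_u$ a weakening of a clause of $G$ or of a resolvent of some $D_v,D_w$ with $v,w<u$; its length is $\ell$. Definition of $\mathrm{RREF}(F,s)$: let $F$ be a CNF with variables $X_1,\dots,X_n$ and non-tautological clauses $C_1,\dots,C_m$; write $X^{(1)}=X$, $X^{(0)}=\bar X$, $\mathrm{B}=\{0,1\}$, $[k]=\{1,\dots,k\}$. The variables are $P[u]$ ($u\in[s]$), $D[u,i,b]$ ($u\in[s],i\in[n],b\in\mathrm{B}$), $V[u,i]$ ($u\in[s],i\in[n]\cup\{0\}$), $I[u,j]$ ($u\in[s],j\in[m]\cup\{0\}$), $L[u,v]$ and $R[u,v]$ ($u\in[s],v\in[s]\cup\{0\}$). The clauses are, for all $u,v\in[s]$ and other parameters as indicated: (A1) $\bar P[u]\vee V[u,0]\vee\dots\vee V[u,n]$; (A2) $\bar P[u]\vee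 I[u,0]\vee\dots\vee I[u,m]$; (A3) $\bar P[u]\vee L[u,0]\vee\dots\vee L[u,s]$; (A4) $\bar P[u]\vee R[u,0]\vee\dots\vee R[u,s]$; (A5) $\bar P[u]\vee\bar V[u,i]\vee\bar V[u,i']$ for $i\ne i'\in[n]\cup\{0\}$; (A6) $\bar P[u]\vee\bar I[u,j]\vee\bar I[u,j']$ for $j\ne j'\in[m]\cup\{0\}$; (A7) $\bar P[u]\vee\bar L[u,v]\vee\bar L[u,v']$ and (A8) $\bar P[u]\vee\bar R[u,v]\vee\bar R[u,v']$ for $v\ne v'\in[s]\cup\{0\}$; (A9) $\bar P[u]\vee\bar I[u,0]\vee\bar V[u,0]$; (A10) $\bar P[u]\vee I[u,0]\vee V[u,0]$; (A11) $\bar P[u]\vee\bar I[u,0]\vee\bar L[u,0]$; (A12) $\bar P[u]\vee\bar I[u,0]\vee\bar R[u,0]$; (A13) $\bar P[u]\vee\bar L[u,v]$ and (A14) $\bar P[u]\vee\bar R[u,v]$ for $u\le v$; (A15) $\bar P[u]\vee\bar P[v]\vee\bar L[u,v]\vee\bar V[u,i]\vee D[v,i,0]$ and (A16) $\bar P[u]\vee\bar P[v]\vee\bar R[u,v]\vee\bar V[u,i]\vee D[v,i,1]$ for $i\in[n]$; (A17) $\bar P[u]\vee\bar P[v]\vee\bar L[u,v]\vee\bar V[u,i]\vee\bar D[v,i',b]\vee D[u,i',b]$ and (A18) $\bar P[u]\vee\bar P[v]\vee\bar R[u,v]\vee\bar V[u,i]\vee\bar D[v,i',b]\vee D[u,i',b]$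 for $i\ne i'\in[n]$, $b\in\mathrm{B}$; (A19) $\bar P[u]\vee\bar I[u,j]\vee D[u,i,b]$ for $j\in[m]$ and $X_i^{(b)}\in C_j$; (A20) $\bar P[u]\vee\bar D[u,i,0]\vee\bar D[u,i,1]$ for $i\in[n]$; (A21) $\bar P[s]\vee\bar D[s,i,b]$ for $i\in[n]$, $b\in\mathrm{B}$; (A22) $\bar P[u]\vee\bar L[u,v]\vee P[v]$; (A23) $\bar P[u]\vee\bar R[u,v]\vee P[v]$; (A24) $P[s]$. -}

module Defs where

open import Data.Nat using (ℕ; zero; suc; _≤_)
open import Data.Bool using (Bool; true; false)
open import Data.Fin using (Fin; toℕ; fromℕ; _<_) renaming (zero to fzero; suc to fsuc)
open import Data.List using (List; []; _∷_; map; allFin)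
open import Data.List.Membership.Propositional using (_∈_)
open import Data.List.Relation.Binary.Subset.Propositional using (_⊆_)
open import Data.Product using (Σ; ∃; ∃-syntax; _×_; _,_)
open import Data.Sum using (_⊎_)
open import Relation.Nullary using (¬_)
open import Relation.Binary.PropositionalEquality using (_≡_; _≢_)

-- A literal X^(b) over variables V is the pair (X , b); X^(1) = X, X^(0) = X̄.
Lit : Set → Set
Lit V = V × Bool

pos : {V : Set} → V → Lit V
pos x = x , true

neg : {V : Set} → V → Lit V
neg x = x , false

-- A clause is a (finite) set of literals, represented by a list
-- (only membership matters).
Clause : Set → Set
Clause V = List (Lit V)

NonTaut : {V : Set} → Clause V → Set
NonTaut C = ∀ x → ¬ (pos x ∈ C × neg x ∈ C)

CNF : Set → Set₁
CNF V = Clause V → Set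

Derived : {V : Set} {ℓ : ℕ} → CNF V → (Fin ℓ → Clause V) → Fin ℓ → Set
Derived {V} G D u =
    (∃[ C ] (G C × C ⊆ D u))
  ⊎ (∃[ v ] ∃[ w ] ∃[ x ] (v < u × w < u × pos x ∈ D v × neg x ∈ D w ×
        -- the resolvent (D v ∖ {x}) ∪ (D w ∖ {x̄}) is contained in D u
        (∀ (l : Lit V) → (l ∈ D v × l ≢ pos x) ⊎ (l ∈ D w × l ≢ neg x) → l ∈ D u)))

-- A Resolution refutation of G of length (suc k): clauses D_1 … D_{k+1}.
record Refutation {V : Set} (G : CNF V) (k : ℕ) : Set where
  field
    cl       : Fin (suc k) → Clause V
    nonTaut  : ∀ u → NonTaut (cl u)
    derived  : ∀ u → Derived G cl u
    lastEmpty : cl (fromℕ k) ≡ []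

Satisfiable : {n m : ℕ} → (Fin m → Clause (Fin n)) → Set
Satisfiable {n} {m} F =
  Σ (Fin n → Bool) λ α → ∀ (j : Fin m) → ∃[ i ] ((i , α i) ∈ F j)

Distinct : {n m : ℕ} → (Fin m → Clause (Fin n)) → Set
Distinct F = ∀ j j' → F j ⊆ F j' → F j' ⊆ F j → j ≡ j'

-- The formula RREF(F, s)
-- Index conventions: u ∈ [s] is  Fin s  (u ↦ u-1);
-- i ∈ [n] is Fin n (i ↦ i-1); i ∈ [n]∪{0} is Fin (suc n) with 0 ↦ fzero
-- and i ∈ [n] ↦ fsuc (i-1); similarly for [m]∪{0} and [s]∪{0}.

data RVar (s n m : ℕ) : Set where
  P   : Fin s → RVar s n m
  D   : Fin s → Fin n → Bool → RVar s n m
  V   : Fin s → Fin (suc n) → RVar s n m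
  I   : Fin s → Fin (suc m) → RVar s n m
  L   : Fin s → Fin (suc s) → RVar s n m
  R   : Fin s → Fin (suc s) → RVar s n m

module _ {n m : ℕ} (F : Fin m → Clause (Fin n)) (s : ℕ) where

  data RREF : Clause (RVar s n m) → Set where
    a1  : ∀ u → RREF (neg (P u) ∷ map (λ i → pos (V u i)) (allFin (suc n)))
    a2  : ∀ u → RREF (neg (P u) ∷ map (λ j → pos (I u j)) (allFin (suc m)))
    a3  : ∀ u → RREF (neg (P u) ∷ map (λ v → pos (L u v)) (allFin (suc s)))
    a4  : ∀ u → RREF (neg (P u) ∷ map (λ v → pos (R u v)) (allFin (suc s)))
    a5  : ∀ u i i' → i ≢ i' → RREF (neg (P u) ∷ neg (V u i) ∷ neg (V u i') ∷ [])
    a6  : ∀ u j j' → j ≢ j' → RREF (neg (P u) ∷ neg (I u j) ∷ neg (I u j') ∷ [])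
    a7  : ∀ u v v' → v ≢ v' → RREF (neg (P u) ∷ neg (L u v) ∷ neg (L u v') ∷ [])
    a8  : ∀ u v v' → v ≢ v' → RREF (neg (P u) ∷ neg (R u v) ∷ neg (R u v') ∷ [])
    a9  : ∀ u → RREF (neg (P u) ∷ neg (I u fzero) ∷ neg (V u fzero) ∷ [])
    a10 : ∀ u → RREF (neg (P u) ∷ pos (I u fzero) ∷ pos (V u fzero) ∷ [])
    a11 : ∀ u → RREF (neg (P u) ∷ neg (I u fzero) ∷ neg (L u fzero) ∷ [])
    a12 : ∀ u → RREF (neg (P u) ∷ neg (I u fzero) ∷ neg (R u fzero) ∷ [])
    a13 : ∀ u (v : Fin s) → toℕ u ≤ toℕ v → RREF (neg (P u) ∷ neg (L u (fsuc v)) ∷ [])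
    a14 : ∀ u (v : Fin s) → toℕ u ≤ toℕ v → RREF (neg (P u) ∷ neg (R u (fsuc v)) ∷ [])
    a15 : ∀ u v (i : Fin n) →
          RREF (neg (P u) ∷ neg (P v) ∷ neg (L u (fsuc v)) ∷ neg (V u (fsuc i)) ∷ pos (D v i false) ∷ [])
    a16 : ∀ u v (i : Fin n) →
          RREF (neg (P u) ∷ neg (P v) ∷ neg (R u (fsuc v)) ∷ neg (V u (fsuc i)) ∷ pos (D v i true) ∷ [])
    a17 : ∀ u v (i i' : Fin n) → i ≢ i' → ∀ b →
          RREF (neg (P u) ∷ neg (P v) ∷ neg (L u (fsuc v)) ∷ neg (V u (fsuc i)) ∷
                neg (D v i' b) ∷ pos (D u i' b) ∷ [])
    a18 : ∀ u v (i i' : Fin n) → i ≢ i' → ∀ b →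
          RREF (neg (P u) ∷ neg (P v) ∷ neg (R u (fsuc v)) ∷ neg (V u (fsuc i)) ∷
                neg (D v i' b) ∷ pos (D u i' b) ∷ [])
    a19 : ∀ u (j : Fin m) (i : Fin n) b → (i , b) ∈ F j →
          RREF (neg (P u) ∷ neg (I u (fsuc j)) ∷ pos (D u i b) ∷ [])
    a20 : ∀ u (i : Fin n) → RREF (neg (P u) ∷ neg (D u i false) ∷ neg (D u i true) ∷ [])
    -- u here is the last index s (i.e. toℕ u + 1 ≡ s)
    a21 : ∀ (u : Fin s) → suc (toℕ u) ≡ s → ∀ (i : Fin n) b → RREF (neg (P u) ∷ neg (D u i b) ∷ [])
    a22 : ∀ u (v : Fin s) → RREF (neg (P u) ∷ neg (L u (fsuc v)) ∷ pos (P v) ∷ [])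
    a23 : ∀ u (v : Fin s) → RREF (neg (P u) ∷ neg (R u (fsuc v)) ∷ pos (P v) ∷ [])
    a24 : ∀ (u : Fin s) → suc (toℕ u) ≡ s → RREF (pos (P u) ∷ [])

module Submission where

-- RREF(F,s) claims a Resolution refutation of F with rows 1, …, s: P[u] says
-- row u is present, D[u,i,b] that Xᵢ^(b) lies in its clause.  Fix an assignment
-- α satisfying F and derive, for u = 1, …, s in turn, the clause
--   T u = D[u,1,α₁] ∨ … ∨ D[u,n,αₙ] ∨ ¬P[u],
-- "a present row contains a literal true under α".  A row is either a weakened
-- clause C_j of F (A19 supplies its literal true under α), or a resolvent on
-- some Xᵢ of two earlier rows; the premise holding the literal of Xᵢ false
-- under α has, by T of that premise, another true literal, which A17/A18 copy
-- into row u (A15/A16 with A20 exclude it being the pivot literal).  Finally A24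
-- and A21 refute T of the last row.  Each T u comes from eliminating the
-- disjunctions A2 (origin of the row), A1 (pivot) and A3/A4 (pointer) with
-- O(s·n²·m) clauses in all, so s rows cost O((s·n·m)²).

open import Defs
open import Data.Nat
  using (ℕ; zero; suc; _≤_; _<_; _+_; _*_; _^_; z≤n; s≤s; _≤?_; NonZero; >-nonZero)
open import Data.Nat.Properties
  using ( ≤-refl; ≤-reflexive; ≤-trans; <⇒≤; ≰⇒>; <-irrefl; n≤1+n; m≤n⇒m≤1+n
        ; m<1+n⇒m<n∨m≡n; ∸-monoʳ-<; +-mono-≤; +-monoˡ-≤; +-monoʳ-≤; *-mono-≤; *-monoʳ-≤
        ; m≤m+n; m≤m*n; m≤n*m; m*n≢0; +-identityʳ; *-identityʳ; module ≤-Reasoning )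
open import Data.Nat.Tactic.RingSolver using (solve-∀)
open import Data.Bool using (Bool; true; false; not)
open import Data.Fin using (Fin; toℕ; fromℕ; fromℕ<; opposite)
  renaming (zero to fzero; suc to fsuc)
open import Data.Fin.Properties
  using (opposite-prop; opposite-involutive; toℕ<n; toℕ-injective; toℕ-fromℕ; toℕ-fromℕ<)
  renaming (_≟_ to _≟ᶠ_)
open import Data.List using (List; []; _∷_; map; allFin; tabulate; _++_; length; lookup)
open import Data.List.Properties using (length-++; ++-assoc; ++-identityʳ; length-tabulate)
open import Data.List.Membership.Propositional using (_∈_)
open import Data.List.Membership.Propositional.Properties using (∈-map⁺; ∈-allFin)
open import Data.List.Relation.Binary.Subset.Propositional using (_⊆_)
open import Data.List.Relation.Binary.Subset.Propositional.Properties
  using (⊆-refl; ⊆-reflexive; xs⊆xs++ys; xs⊆ys++xs; ++⁺ʳ)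
open import Data.List.Relation.Unary.All as All using (All; []; _∷_)
import Data.List.Relation.Unary.All.Properties as All
open import Data.List.Relation.Unary.Any using (here; there; index)
open import Data.List.Relation.Unary.Any.Properties using (lookup-index)
open import Data.Product using (∃-syntax; _×_; _,_; proj₁; proj₂)
open import Data.Sum using (_⊎_; inj₁; inj₂)
open import Data.Empty using (⊥-elim)
open import Function using (_∘_)
open import Relation.Nullary using (yes; no; does)
open import Relation.Nullary.Decidable using (dec-true; dec-false)
open import Relation.Binary.PropositionalEquality

module Resolution {V : Set} (G : CNF V) where

  Resolves : Clause V → Clause V → V → Clause V → Set
  Resolves C₁ C₂ x Y =
    ∀ (l : Lit V) → (l ∈ C₁ × l ≢ pos x) ⊎ (l ∈ C₂ × l ≢ neg x) → l ∈ Y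

  Step : List (Clause V) → Clause V → Set
  Step Λ C = (∃[ A ] (G A × A ⊆ C))
           ⊎ (∃[ C₁ ] ∃[ C₂ ] ∃[ x ]
               (C₁ ∈ Λ × C₂ ∈ Λ × pos x ∈ C₁ × neg x ∈ C₂ × Resolves C₁ C₂ x C))

  step-mono : ∀ {Λ Λ' C} → Λ ⊆ Λ' → Step Λ C → Step Λ' C
  step-mono _   (inj₁ ax) = inj₁ ax
  step-mono Λ⊆ (inj₂ (C₁ , C₂ , x , m₁ , m₂ , r)) = inj₂ (C₁ , C₂ , x , Λ⊆ m₁ , Λ⊆ m₂ , r)

  -- A chain over the hypotheses Γ: non-tautological clauses listed newest
  -- first, each a step from the older ones and Γ.  A chain over [] whose
  -- newest clause is empty is a refutation read backwards.
  data Chain (Γ : List (Clause V)) : List (Clause V) → Set where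
    []     : Chain Γ []
    extend : ∀ {Δ C} → Chain Γ Δ → NonTaut C → Step (Δ ++ Γ) C → Chain Γ (C ∷ Δ)

  reassoc : ∀ Δ' {Δ Γ : List (Clause V)} → Δ' ++ (Δ ++ Γ) ⊆ (Δ' ++ Δ) ++ Γ
  reassoc Δ' {Δ} {Γ} = ⊆-reflexive (sym (++-assoc Δ' Δ Γ))

  chain-mono : ∀ {Γ Γ' Δ} → Γ ⊆ Γ' → Chain Γ Δ → Chain Γ' Δ
  chain-mono Γ⊆ []                        = []
  chain-mono Γ⊆ (extend {Δ} c nt st) = extend (chain-mono Γ⊆ c) nt (step-mono (++⁺ʳ Δ Γ⊆) st)

  chain-++ : ∀ {Γ Δ Δ'} → Chain Γ Δ → Chain (Δ ++ Γ) Δ' → Chain Γ (Δ' ++ Δ)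
  chain-++ c []                       = c
  chain-++ c (extend {Δ'} c' nt st) = extend (chain-++ c c') nt (step-mono (reassoc Δ') st)

  stack : ∀ (Δ' Δ : List (Clause V)) {a b} → length Δ' ≤ a → length Δ ≤ b → length (Δ' ++ Δ) ≤ a + b
  stack Δ' Δ len' len = ≤-trans (≤-reflexive (length-++ Δ')) (+-mono-≤ len' len)

  older : (Λ : List (Clause V)) → Fin (length Λ) → List (Clause V)
  older (_ ∷ Λ) fzero    = Λ
  older (_ ∷ Λ) (fsuc p) = older Λ p

  older-index : ∀ (Λ : List (Clause V)) p {C} → C ∈ older Λ p →
                ∃[ q ] (toℕ p < toℕ q × lookup Λ q ≡ C)
  older-index (_ ∷ Λ) fzero    C∈ = fsuc (index C∈) , s≤s z≤n , sym (lookup-index C∈)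
  older-index (_ ∷ Λ) (fsuc p) C∈ with older-index Λ p C∈
  ... | q , p<q , eq = fsuc q , s≤s p<q , eq

  step-at : ∀ {Γ Λ} → Chain Γ Λ → ∀ p →
            NonTaut (lookup Λ p) × Step (older Λ p ++ Γ) (lookup Λ p)
  step-at (extend c nt st) fzero    = nt , st
  step-at (extend c _ _)   (fsuc p) = step-at c p

  opposite-< : ∀ {k} (i j : Fin k) → toℕ i < toℕ j → toℕ (opposite j) < toℕ (opposite i)
  opposite-< i j i<j rewrite opposite-prop i | opposite-prop j =
    ∸-monoʳ-< (s≤s i<j) (toℕ<n j)

  chain⇒refutation : ∀ {Δ} → Chain [] ([] ∷ Δ) → Refutation G (length Δ)
  chain⇒refutation {Δ} c = record
    { cl        = cl
    ; nonTaut   = λ u → proj₁ (step-at c (opposite u))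
    ; derived   = derived
    ; lastEmpty = cong (lookup Λ) (opposite-involutive fzero)
    }
    where
    Λ = [] ∷ Δ
    cl : Fin (suc (length Δ)) → Clause V
    cl u = lookup Λ (opposite u)

    earlier : ∀ u {C} → C ∈ older Λ (opposite u) ++ [] → ∃[ v ] (toℕ v < toℕ u × cl v ≡ C)
    earlier u {C} C∈ with older-index Λ (opposite u) (subst (C ∈_) (++-identityʳ _) C∈)
    ... | q , u<q , eq =
      opposite q ,
      subst (λ w → toℕ (opposite q) < toℕ w) (opposite-involutive u) (opposite-< _ q u<q) ,
      trans (cong (lookup Λ) (opposite-involutive q)) eq

    derived : ∀ u → Derived G cl u
    derived u with proj₂ (step-at c (opposite u))
    ... | inj₁ ax = inj₁ ax
    ... | inj₂ (C₁ , C₂ , x , m₁ , m₂ , p , q , r) with earlier u m₁ | earlier u m₂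
    ... | v , v<u , refl | w , w<u , refl = inj₂ (v , w , x , v<u , w<u , p , q , r)

  chain-until : ∀ {Γ Λ C} → Chain Γ Λ → C ∈ Λ → ∃[ Δ ] (Chain Γ (C ∷ Δ) × length Δ < length Λ)
  chain-until c                 (here refl) = _ , c , ≤-refl
  chain-until (extend c _ _) (there C∈) with chain-until c C∈
  ... | Δ , c' , Δ<Λ = Δ , c' , m≤n⇒m≤1+n Δ<Λ

  refutation-within : ∀ {Λ} → Chain [] Λ → [] ∈ Λ ++ [] →
                      ∃[ k ] (Refutation G k × suc k ≤ length Λ)
  refutation-within {Λ} c []∈ with chain-until c (subst ([] ∈_) (++-identityʳ Λ) []∈)
  ... | Δ , c' , Δ<Λ = length Δ , chain⇒refutation c' , Δ<Λ

  Derivable : List (Clause V) → Clause V → ℕ → Set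
  Derivable Γ X k = ∃[ Δ ] (Chain Γ Δ × length Δ ≤ k × X ∈ Δ ++ Γ)

  relax : ∀ {Γ X k k'} → k ≤ k' → Derivable Γ X k → Derivable Γ X k'
  relax k≤k' (Δ , c , len , X∈) = Δ , c , ≤-trans len k≤k' , X∈

  by-hypothesis : ∀ {Γ X} → X ∈ Γ → Derivable Γ X 0
  by-hypothesis X∈ = [] , [] , z≤n , X∈

  by-axiom : ∀ {Γ X A} → G A → A ⊆ X → NonTaut X → Derivable Γ X 1
  by-axiom {X = X} ax A⊆X nt = X ∷ [] , extend [] nt (inj₁ (_ , ax , A⊆X)) , ≤-refl , here refl

  continue : ∀ {Γ Δ X k} → Chain Γ Δ → Derivable (Δ ++ Γ) X k →
             ∃[ Δ' ] (Chain Γ (Δ' ++ Δ) × length Δ' ≤ k × X ∈ (Δ' ++ Δ) ++ Γ)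
  continue c (Δ' , c' , len , X∈) = Δ' , chain-++ c c' , len , reassoc Δ' X∈

  refutation-after : ∀ {Δ a b} → Chain [] Δ → length Δ ≤ b → Derivable (Δ ++ []) [] a →
                     ∃[ k ] (Refutation G k × suc k ≤ a + b)
  refutation-after c len d with continue c d
  ... | Δ' , c' , len' , []∈ with refutation-within c' []∈
  ... | k , refutes , k<Λ = k , refutes , ≤-trans k<Λ (stack Δ' _ len' len)

  both : ∀ {Γ X₁ X₂ a b} → Derivable Γ X₁ a → Derivable Γ X₂ b →
         ∃[ Δ ] (Chain Γ Δ × length Δ ≤ a + b × X₁ ∈ Δ ++ Γ × X₂ ∈ Δ ++ Γ)
  both {Γ} (Δ₁ , c₁ , len₁ , X₁∈) (Δ₂ , c₂ , len₂ , X₂∈) =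
    Δ₁ ++ Δ₂ ,
    chain-++ c₂ (chain-mono Γ⊆ c₁) ,
    stack Δ₁ Δ₂ len₁ len₂ ,
    reassoc Δ₁ (++⁺ʳ Δ₁ Γ⊆ X₁∈) ,
    reassoc Δ₁ (xs⊆ys++xs (Δ₂ ++ Γ) Δ₁ X₂∈)
    where
    Γ⊆ : Γ ⊆ Δ₂ ++ Γ
    Γ⊆ = xs⊆ys++xs Γ Δ₂

  by-resolution : ∀ {Γ X₁ X₂ Y x a b} → Derivable Γ X₁ a → Derivable Γ X₂ b →
                  pos x ∈ X₁ → neg x ∈ X₂ → Resolves X₁ X₂ x Y → NonTaut Y →
                  Derivable Γ Y (suc (a + b))
  by-resolution {Y = Y} {x} d₁ d₂ p q r nt with both d₁ d₂
  ... | Δ , c , len , X₁∈ , X₂∈ =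
    Y ∷ Δ , extend c nt (inj₂ (_ , _ , x , X₁∈ , X₂∈ , p , q , r)) , s≤s len , here refl

  Conformant : (V → Bool) → Clause V → Set
  Conformant σ = All (λ l → proj₂ l ≡ σ (proj₁ l))

  conformant⇒nonTaut : ∀ {σ C} → Conformant σ C → NonTaut C
  conformant⇒nonTaut c x (p , q) with trans (All.lookup c p) (sym (All.lookup c q))
  ... | ()

  listed : ∀ {C Y : Clause V} → All (_∈ Y) C → C ⊆ Y
  listed = All.lookup

  Covers : Lit V → Clause V → Clause V → Set
  Covers e Y = All (λ l → l ≡ e ⊎ l ∈ Y)

  outside : ∀ {e Y C l} → Covers e Y C → l ∈ C → l ≢ e → l ∈ Y
  outside c l∈ l≢e with All.lookup c l∈
  ... | inj₁ l≡e = ⊥-elim (l≢e l≡e)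
  ... | inj₂ l∈Y = l∈Y

  covers⇒resolves : ∀ {x Y C₁ C₂} → Covers (pos x) Y C₁ → Covers (neg x) Y C₂ →
                    Resolves C₁ C₂ x Y
  covers⇒resolves c₁ c₂ l (inj₁ (l∈ , l≢x)) = outside c₁ l∈ l≢x
  covers⇒resolves c₁ c₂ l (inj₂ (l∈ , l≢x̄)) = outside c₂ l∈ l≢x̄

  pivot∷ : ∀ {e Y Z} → Z ⊆ Y → Covers e Y (e ∷ Z)
  pivot∷ Z⊆Y = inj₁ refl ∷ All.tabulate (inj₂ ∘ Z⊆Y)

  cut : ∀ {Γ x A T₀ T a b} → Derivable Γ (pos x ∷ A ++ T₀) a → Derivable Γ (neg x ∷ T) b →
        T₀ ⊆ T → NonTaut (A ++ T) → Derivable Γ (A ++ T) (suc (a + b))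
  cut {A = A} {T = T} d₁ d₂ T₀⊆T = by-resolution d₁ d₂ (here refl) (here refl)
    (covers⇒resolves (pivot∷ (++⁺ʳ A T₀⊆T)) (pivot∷ (xs⊆ys++xs T A)))

  -- Positive literals of σ-positive variables keep a σ-conformant clause
  -- non-tautological: the clauses met during an elimination are harmless.
  positives-nonTaut : ∀ {X : Set} (f : X → V) {σ T} → (∀ y → σ (f y) ≡ true) →
                      Conformant σ T → ∀ xs → NonTaut (map (pos ∘ f) xs ++ T)
  positives-nonTaut f f-positive T-conformant xs = conformant⇒nonTaut
    (All.++⁺ (All.map⁺ (All.universal (sym ∘ f-positive) xs)) T-conformant)

  start-from-axiom : ∀ {X : Set} {Γ T p} (f : X → V) {σ} xs →
                     G (neg p ∷ map (pos ∘ f) xs) → neg p ∈ T →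
                     (∀ y → σ (f y) ≡ true) → Conformant σ T →
                     Derivable Γ (map (pos ∘ f) xs ++ T) 1
  start-from-axiom {T = T} f xs ax ¬p∈T f-positive T-conformant =
    by-axiom ax weaken (positives-nonTaut f f-positive T-conformant xs)
    where
    weaken : neg _ ∷ map (pos ∘ f) xs ⊆ map (pos ∘ f) xs ++ T
    weaken (here refl) = xs⊆ys++xs T _ ¬p∈T
    weaken (there l∈)  = xs⊆xs++ys _ T l∈

  -- Resolving away the positive literals  pos (f y)  one at a time against
  -- side derivations of  neg (f y) ∷ T  leaves T; each round costs one
  -- resolution plus one side derivation.
  module Elimination {X : Set} {Γ T b} (f : X → V) {σ : V → Bool}
                     (f-positive : ∀ y → σ (f y) ≡ true) (T-conformant : Conformant σ T)
                     (side : ∀ y → Derivable Γ (neg (f y) ∷ T) b) where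

    -- one round followed by L rounds is L + 1 rounds
    cost-shift : ∀ a b L → suc (a + b) + L * suc b ≡ a + suc L * suc b
    cost-shift = solve-∀

    -- the first round may also weaken the rest T₀ of the starting clause to T
    eliminate : ∀ {T₀ a} x xs → T₀ ⊆ T → Derivable Γ (map (pos ∘ f) (x ∷ xs) ++ T₀) a →
                Derivable Γ T (a + length (x ∷ xs) * suc b)
    eliminate-rest : ∀ {a} xs → Derivable Γ (map (pos ∘ f) xs ++ T) a →
                     Derivable Γ T (a + length xs * suc b)

    eliminate {a = a} x xs T₀⊆T d =
      relax (≤-reflexive (cost-shift a b (length xs)))
            (eliminate-rest xs (cut d (side x) T₀⊆T (positives-nonTaut f f-positive T-conformant xs)))

    eliminate-rest {a} []       d = relax (m≤m+n a 0) d
    eliminate-rest     (x ∷ xs) d = eliminate x xs ⊆-refl d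

  eliminate-all : ∀ {k Γ T₀ T a b} .{{_ : NonZero k}} (f : Fin k → V) {σ : V → Bool} →
                  (∀ y → σ (f y) ≡ true) → Conformant σ T → T₀ ⊆ T →
                  Derivable Γ (map (pos ∘ f) (allFin k) ++ T₀) a →
                  (∀ y → Derivable Γ (neg (f y) ∷ T) b) →
                  Derivable Γ T (a + k * suc b)
  eliminate-all {suc k} {Γ} {T = T} {a} {b} f f-positive T-conformant T₀⊆T d side =
    subst (λ L → Derivable Γ T (a + suc L * suc b)) (length-tabulate {n = k} fsuc)
          (eliminate fzero (tabulate fsuc) T₀⊆T d)
    where open Elimination f f-positive T-conformant side

-- Each budget but the first and last is "one axiom plus k rounds of
-- elimination", i.e. 1 + k · (1 + previous budget).
premise-cost : ℕ → ℕ
premise-cost n = 2 + n * 4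

pivot-cost : ℕ → ℕ → ℕ
pivot-cost n s = 1 + suc s * suc (premise-cost n)

resolvent-cost : ℕ → ℕ → ℕ
resolvent-cost n s = 1 + suc n * suc (pivot-cost n s)

row-cost : ℕ → ℕ → ℕ → ℕ
row-cost n m s = 1 + suc m * suc (resolvent-cost n s)

final-cost : ℕ → ℕ
final-cost n = 2 + n * 2

suc≤double : ∀ x .{{_ : NonZero x}} → suc x ≤ 2 * x
suc≤double x@(suc _) = begin
  suc x   ≤⟨ +-monoˡ-≤ x (s≤s z≤n) ⟩
  x + x   ≡⟨ cong (x +_) (sym (+-identityʳ x)) ⟩
  2 * x   ∎
  where open ≤-Reasoning

-- One more level of elimination over x + 1 alternatives: a bound K·y on the
-- inner budget (plus one) becomes a bound (2 + 2K)·(x·y) on the outer one.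
nest : ∀ {c K y} x .{{_ : NonZero x}} .{{_ : NonZero y}} →
       suc c ≤ K * y → suc (1 + suc x * suc c) ≤ (2 + 2 * K) * (x * y)
nest {c} {K} {y} x bound = begin
  2 + suc x * suc c         ≤⟨ +-monoʳ-≤ 2 (*-mono-≤ (suc≤double x) bound) ⟩
  2 + 2 * x * (K * y)       ≡⟨ regroup x y K ⟩
  2 + 2 * K * (x * y)       ≤⟨ +-monoˡ-≤ (2 * K * (x * y)) (m≤m*n 2 (x * y)) ⟩
  2 * (x * y) + 2 * K * (x * y) ≡⟨ collect x y K ⟩
  (2 + 2 * K) * (x * y)     ∎
  where
  open ≤-Reasoning
  instance _ = m*n≢0 x y
  regroup : ∀ x y K → 2 + 2 * x * (K * y) ≡ 2 + 2 * K * (x * y)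
  regroup = solve-∀
  collect : ∀ x y K → 2 * (x * y) + 2 * K * (x * y) ≡ (2 + 2 * K) * (x * y)
  collect = solve-∀

absorb : ∀ a b n .{{_ : NonZero n}} → a + n * b ≤ (a + b) * n
absorb a b n = begin
  a + n * b     ≤⟨ +-monoˡ-≤ (n * b) (m≤m*n a n) ⟩
  a * n + n * b ≡⟨ regroup a b n ⟩
  (a + b) * n   ∎
  where
  open ≤-Reasoning
  regroup : ∀ a b n → a * n + n * b ≡ (a + b) * n
  regroup = solve-∀

-- The total length, s rows and the final contradiction, is O((s·n·m)²):
-- unfolding the nested budgets gives  row-cost < 70·s·n²·m.
total-bound : ∀ n m s .{{_ : NonZero n}} .{{_ : NonZero m}} .{{_ : NonZero s}} →
              final-cost n + s * row-cost n m s ≤ 74 * (s * n * m) ^ 2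
total-bound n m s = begin
  final-cost n + s * row-cost n m s
    ≤⟨ +-mono-≤ final-bound (*-monoʳ-≤ s (≤-trans (n≤1+n _) row-bound)) ⟩
  4 * (X * X) + s * (70 * (m * (n * (s * n))))
    ≡⟨ cong (4 * (X * X) +_) (regroup s n m) ⟩
  4 * (X * X) + 70 * (X * (s * n))
    ≤⟨ +-monoʳ-≤ (4 * (X * X)) (*-monoʳ-≤ 70 (*-monoʳ-≤ X (m≤m*n (s * n) m))) ⟩
  4 * (X * X) + 70 * (X * X)
    ≡⟨ collect X ⟩
  74 * (X * X)
    ≡⟨ cong (λ y → 74 * (X * y)) (sym (*-identityʳ X)) ⟩
  74 * X ^ 2 ∎
  where
  open ≤-Reasoning
  X = s * n * m
  instance
    _ = m*n≢0 s n
    _ = m*n≢0 (s * n) m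
    _ = m*n≢0 n (s * n)
  premise-bound : suc (premise-cost n) ≤ 7 * n
  premise-bound = absorb 3 4 n
  row-bound : suc (row-cost n m s) ≤ 70 * (m * (n * (s * n)))
  row-bound = nest {K = 34} m (nest {K = 16} n (nest {K = 7} s premise-bound))
  final-bound : final-cost n ≤ 4 * (X * X)
  final-bound = begin
    final-cost n ≤⟨ absorb 2 2 n ⟩
    4 * n       ≤⟨ *-monoʳ-≤ 4 n≤X² ⟩
    4 * (X * X) ∎
    where
    n≤X² : n ≤ X * X
    n≤X² = ≤-trans (m≤n*m n s) (≤-trans (m≤m*n (s * n) m) (m≤m*n X X))
  regroup : ∀ s n m → s * (70 * (m * (n * (s * n)))) ≡ 70 * (s * n * m * (s * n))
  regroup = solve-∀
  collect : ∀ x → 4 * (x * x) + 70 * (x * x) ≡ 74 * (x * x)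
  collect = solve-∀

pattern at₀ = here refl
pattern at₁ = there at₀
pattern at₂ = there at₁
pattern at₃ = there at₂
pattern at₄ = there at₃
pattern there² l∈ = there (there l∈)
pattern there³ l∈ = there (there (there l∈))
pattern there⁵ l∈ = there (there (there (there (there l∈))))

module RREFRefutation {n m s : ℕ} .{{_ : NonZero n}} (F : Fin m → Clause (Fin n))
                      (α : Fin n → Bool) (α⊨F : ∀ j → ∃[ i ] ((i , α i) ∈ F j)) where

  open Resolution (RREF F s)

  Var : Set
  Var = RVar s n m

  Cl : Set
  Cl = Clause Var

  T : Fin s → Cl
  T u = map (λ i → pos (D u i (α i))) (allFin n) ++ neg (P u) ∷ []

  ¬P∈T : ∀ u → neg (P u) ∈ T u
  ¬P∈T u = xs⊆ys++xs _ (map (λ i → pos (D u i (α i))) (allFin n)) at₀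

  D∈T : ∀ u i → pos (D u i (α i)) ∈ T u
  D∈T u i = xs⊆xs++ys _ _ (∈-map⁺ (λ i → pos (D u i (α i))) (∈-allFin i))

  Available : Fin s → List Cl → Set
  Available u Γ = ∀ v → toℕ v < toℕ u → T v ∈ Γ

  -- Sign patterns witnessing non-tautology (via conformance): the sign of P[w]
  -- and D[w,_,_] may depend on the row w, the others are uniform.
  signs : (Fin s → Bool) → Bool → Bool → Bool → (Fin s → Bool) → Var → Bool
  signs onP onV onI onPtr onD (P w)     = onP w
  signs onP onV onI onPtr onD (D w _ _) = onD w
  signs onP onV onI onPtr onD (V _ _)   = onV
  signs onP onV onI onPtr onD (I _ _)   = onI
  signs onP onV onI onPtr onD (L _ _)   = onPtr
  signs onP onV onI onPtr onD (R _ _)   = onPtr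

  never always : Fin s → Bool
  never  _ = false
  always _ = true

  onlyAt : Fin s → Fin s → Bool
  onlyAt u w = does (w ≟ᶠ u)

  onlyAt-self : ∀ u → true ≡ onlyAt u u
  onlyAt-self u = sym (dec-true (u ≟ᶠ u) refl)

  onlyAt-other : ∀ {u w} → w ≢ u → false ≡ onlyAt u w
  onlyAt-other {u} {w} w≢u = sym (dec-false (w ≟ᶠ u) w≢u)

  T-conformant : ∀ {onP onV onI onPtr onD} u → false ≡ onP u → true ≡ onD u →
                 Conformant (signs onP onV onI onPtr onD) (T u)
  T-conformant u P-neg D-pos = All.++⁺ (All.map⁺ (All.universal (λ _ → D-pos) (allFin n))) (P-neg ∷ [])

  negative : ∀ {C : Cl} → Conformant (λ _ → false) C → NonTaut C
  negative = conformant⇒nonTaut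

  -- The pointer to the left (b = true) or right (b = false) premise of row u.
  -- Through a left pointer A15 puts X̄ᵢ = D[v,i,0] into the premise, through a
  -- right pointer A16 puts Xᵢ = D[v,i,1]; so the pointer towards a premise
  -- containing the literal falsified by α is  Child (α i).
  Child : Bool → Fin s → Fin (suc s) → Var
  Child true  = L
  Child false = R

  signs-Child : ∀ {onP onV onI onPtr onD} b u w → onPtr ≡ signs onP onV onI onPtr onD (Child b u w)
  signs-Child true  u w = refl
  signs-Child false u w = refl

  pointer-exists : ∀ b u → RREF F s (neg (P u) ∷ map (pos ∘ Child b u) (allFin (suc s)))
  pointer-exists true  u = a3 u
  pointer-exists false u = a4 u

  axiom-no-pointer : ∀ b u → RREF F s (neg (P u) ∷ neg (I u fzero) ∷ neg (Child b u fzero) ∷ [])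
  axiom-no-pointer true  u = a11 u
  axiom-no-pointer false u = a12 u

  pointer-backwards : ∀ b u v → toℕ u ≤ toℕ v → RREF F s (neg (P u) ∷ neg (Child b u (fsuc v)) ∷ [])
  pointer-backwards true  u v u≤v = a13 u v u≤v
  pointer-backwards false u v u≤v = a14 u v u≤v

  pointer-literal : ∀ b u v i →
    RREF F s (neg (P u) ∷ neg (P v) ∷ neg (Child b u (fsuc v)) ∷ neg (V u (fsuc i)) ∷ pos (D v i (not b)) ∷ [])
  pointer-literal true  u v i = a15 u v i
  pointer-literal false u v i = a16 u v i

  pointer-inherits : ∀ b u v i i' → i ≢ i' → ∀ c →
    RREF F s (neg (P u) ∷ neg (P v) ∷ neg (Child b u (fsuc v)) ∷ neg (V u (fsuc i)) ∷
              neg (D v i' c) ∷ pos (D u i' c) ∷ [])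
  pointer-inherits true  u v i i' i≢i' c = a17 u v i i' i≢i' c
  pointer-inherits false u v i i' i≢i' c = a18 u v i i' i≢i' c

  pointer-present : ∀ b u v → RREF F s (neg (P u) ∷ neg (Child b u (fsuc v)) ∷ pos (P v) ∷ [])
  pointer-present true  u v = a22 u v
  pointer-present false u v = a23 u v

  -- "If row u is present and is a resolvent on Xᵢ, then T u."
  Pivot : Fin s → Fin n → Cl
  Pivot u i = neg (V u (fsuc i)) ∷ neg (I u fzero) ∷ T u

  -- "... and its premise in direction αᵢ is row v, then T u."
  Premise : Fin s → Fin s → Fin n → Cl
  Premise u v i = neg (Child (α i) u (fsuc v)) ∷ Pivot u i

  -- Row u cannot have an earlier row v as its premise in direction αᵢ
  -- without containing a true literal: T v provides some D[v,x,αₓ]; for x ≠ i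
  -- the pointer axiom A17/A18 copies it into row u, and for x = i A15/A16
  -- forces the opposite literal D[v,i,¬αᵢ] into row v, which A20 forbids.
  from-premise : ∀ {Γ} u v i → toℕ v < toℕ u → T v ∈ Γ → Derivable Γ (Premise u v i) (premise-cost n)
  from-premise {Γ} u v i v<u Tv∈Γ =
    by-resolution (by-axiom (pointer-present b u v) ⊆-refl pointer-present-nonTaut)
                  premise-absent at₂ at₀
                  (covers⇒resolves (inj₂ (there³ (¬P∈T u)) ∷ inj₂ at₀ ∷ inj₁ refl ∷ [])
                                   (pivot∷ ⊆-refl))
                  (conformant⇒nonTaut K-conformant)
    where
    b = α i
    K = Premise u v i

    v≢u : v ≢ u
    v≢u v≡u = <-irrefl (cong toℕ v≡u) v<u

    σK = signs never false false false always
    K-conformant : Conformant σK K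
    K-conformant = signs-Child b u (fsuc v) ∷ refl ∷ refl ∷ T-conformant u refl refl

    pointer-present-nonTaut : NonTaut (neg (P u) ∷ neg (Child b u (fsuc v)) ∷ pos (P v) ∷ [])
    pointer-present-nonTaut = conformant⇒nonTaut {σ = signs (onlyAt v) false false false always}
      (onlyAt-other (v≢u ∘ sym) ∷ signs-Child b u (fsuc v) ∷ onlyAt-self v ∷ [])

    σside = signs never false false false (onlyAt u)
    side-conformant : ∀ x → Conformant σside (neg (D v x (α x)) ∷ neg (P v) ∷ K)
    side-conformant x = onlyAt-other v≢u ∷ refl ∷ signs-Child b u (fsuc v) ∷ refl ∷ refl ∷
                        T-conformant u refl (onlyAt-self u)

    -- x = i: resolve A15/A16 with A20 on D[v,i,¬αᵢ]
    excluded : ∀ c → neg (D v i (not c)) ∈ (neg (P v) ∷ neg (D v i false) ∷ neg (D v i true) ∷ [])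
             × Covers (neg (D v i (not c))) (neg (D v i c) ∷ neg (P v) ∷ K)
                      (neg (P v) ∷ neg (D v i false) ∷ neg (D v i true) ∷ [])
    excluded true  = at₁ , inj₂ at₁ ∷ inj₁ refl ∷ inj₂ at₀ ∷ []
    excluded false = at₂ , inj₂ at₁ ∷ inj₂ at₀ ∷ inj₁ refl ∷ []

    pivot-literal : Derivable Γ (neg (D v i b) ∷ neg (P v) ∷ K) 3
    pivot-literal =
      by-resolution
        (by-axiom (pointer-literal b u v i) ⊆-refl
          (conformant⇒nonTaut {σ = signs never false false false always}
            (refl ∷ refl ∷ signs-Child b u (fsuc v) ∷ refl ∷ refl ∷ [])))
        (by-axiom (a20 v i) ⊆-refl (negative (refl ∷ refl ∷ refl ∷ [])))
        at₄ (proj₁ (excluded b))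
        (covers⇒resolves
          (inj₂ (there⁵ (¬P∈T u)) ∷ inj₂ at₁ ∷ inj₂ at₂ ∷ inj₂ at₃ ∷ inj₁ refl ∷ [])
          (proj₂ (excluded b)))
        (conformant⇒nonTaut (side-conformant i))

    -- x ≠ i: A17/A18 copies D[v,x,αₓ] into row u
    literal-gone : ∀ x → Derivable Γ (neg (D v x (α x)) ∷ neg (P v) ∷ K) 3
    literal-gone x with x ≟ᶠ i
    ... | yes refl = pivot-literal
    ... | no x≢i   = relax (s≤s z≤n)
      (by-axiom (pointer-inherits b u v i x (x≢i ∘ sym) (α x))
        (listed (there⁵ (¬P∈T u) ∷ at₁ ∷ at₂ ∷ at₃ ∷ at₀ ∷ there⁵ (D∈T u x) ∷ []))
        (conformant⇒nonTaut (side-conformant x)))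

    premise-absent : Derivable Γ (neg (P v) ∷ K) (0 + n * 4)
    premise-absent =
      eliminate-all (λ x → D v x (α x)) (λ _ → refl) (refl ∷ K-conformant)
                    (λ { at₀ → at₀ }) (by-hypothesis Tv∈Γ) literal-gone

  -- Eliminate the pointer of row u in direction αᵢ (A3/A4): it is absent
  -- (A11/A12), points forward (A13/A14), or points to an earlier row.
  from-pivot : ∀ {Γ} u i → Available u Γ → Derivable Γ (Pivot u i) (pivot-cost n s)
  from-pivot u i available =
    eliminate-all (Child b u) (λ w → sym (signs-Child b u w)) conformant ⊆-refl
      (start-from-axiom (Child b u) (allFin (suc s)) (pointer-exists b u) (there² (¬P∈T u))
                        (λ w → sym (signs-Child b u w)) conformant)
      pointer
    where
    b = α i
    conformant : Conformant (signs never false false true always) (Pivot u i)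
    conformant = refl ∷ refl ∷ T-conformant u refl refl

    absent-nonTaut : ∀ w → NonTaut (neg (Child b u w) ∷ Pivot u i)
    absent-nonTaut w = conformant⇒nonTaut {σ = signs never false false false always}
      (signs-Child b u w ∷ refl ∷ refl ∷ T-conformant u refl refl)

    pointer : ∀ w → Derivable _ (neg (Child b u w) ∷ Pivot u i) (premise-cost n)
    pointer fzero = relax (s≤s z≤n)
      (by-axiom (axiom-no-pointer b u) (listed (there³ (¬P∈T u) ∷ at₂ ∷ at₀ ∷ []))
                (absent-nonTaut fzero))
    pointer (fsuc v) with toℕ u ≤? toℕ v
    ... | yes u≤v = relax (s≤s z≤n)
      (by-axiom (pointer-backwards b u v u≤v) (listed (there³ (¬P∈T u) ∷ at₀ ∷ []))
                (absent-nonTaut (fsuc v)))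
    ... | no u≰v  = from-premise u v i (≰⇒> u≰v) (available v (≰⇒> u≰v))

  -- Row u is a resolvent (I[u,0]): eliminate its pivot variable (A1), which
  -- exists by A9.
  from-resolvent : ∀ {Γ} u → Available u Γ → Derivable Γ (neg (I u fzero) ∷ T u) (resolvent-cost n s)
  from-resolvent u available =
    eliminate-all (V u) (λ _ → refl) conformant ⊆-refl
      (start-from-axiom (V u) (allFin (suc n)) (a1 u) (there (¬P∈T u)) (λ _ → refl) conformant)
      pivot
    where
    conformant : Conformant (signs never true false false always) (neg (I u fzero) ∷ T u)
    conformant = refl ∷ T-conformant u refl refl

    pivot : ∀ i → Derivable _ (neg (V u i) ∷ neg (I u fzero) ∷ T u) (pivot-cost n s)
    pivot fzero    = relax (s≤s z≤n)
      (by-axiom (a9 u) (listed (there² (¬P∈T u) ∷ at₁ ∷ at₀ ∷ []))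
                (conformant⇒nonTaut {σ = signs never false false false always}
                  (refl ∷ refl ∷ T-conformant u refl refl)))
    pivot (fsuc i) = from-pivot u i available

  -- Every row clause T u is derivable from the earlier ones: eliminate the
  -- origin of row u (A2); an axiom C_j (A19) contains a literal true under α.
  row : ∀ {Γ} u → Available u Γ → Derivable Γ (T u) (row-cost n m s)
  row u available =
    eliminate-all (I u) (λ _ → refl) conformant ⊆-refl
      (start-from-axiom (I u) (allFin (suc m)) (a2 u) (¬P∈T u) (λ _ → refl) conformant)
      origin
    where
    conformant : Conformant (signs never false true false always) (T u)
    conformant = T-conformant u refl refl

    origin : ∀ j → Derivable _ (neg (I u j) ∷ T u) (resolvent-cost n s)
    origin fzero    = from-resolvent u available
    origin (fsuc j) with α⊨F j
    ... | i , i∈Cⱼ = relax (s≤s z≤n)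
      (by-axiom (a19 u j i (α i) i∈Cⱼ) (listed (there (¬P∈T u) ∷ at₀ ∷ there (D∈T u i) ∷ []))
                (conformant⇒nonTaut {σ = signs never false false false always}
                  (refl ∷ T-conformant u refl refl)))

  -- The last row is present (A24) but has no literals (A21).
  last-row : ∀ {Γ} u → suc (toℕ u) ≡ s → T u ∈ Γ → Derivable Γ [] (final-cost n)
  last-row u last Tu∈Γ =
    by-resolution (by-axiom (a24 u last) ⊆-refl
                    (conformant⇒nonTaut {σ = signs always false false false always} (refl ∷ [])))
                  row-absent at₀ at₀ (covers⇒resolves (inj₁ refl ∷ []) (pivot∷ ⊆-refl))
                  (λ _ ())
    where
    row-absent : Derivable _ (neg (P u) ∷ []) (0 + n * 2)
    row-absent =
      eliminate-all (λ i → D u i (α i)) {σ = signs never false false false always}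
        (λ _ → refl) (refl ∷ []) ⊆-refl (by-hypothesis Tu∈Γ)
        (λ i → by-axiom (a21 u last i (α i)) (listed (at₁ ∷ at₀ ∷ []))
                        (negative (refl ∷ refl ∷ [])))

  Rows : ℕ → Set
  Rows k = ∃[ Δ ] (Chain [] Δ × length Δ ≤ k * row-cost n m s × (∀ v → toℕ v < k → T v ∈ Δ ++ []))

  add-row : ∀ {k} (u : Fin s) → toℕ u ≡ k → Rows k → Rows (suc k)
  add-row u refl (Δ , c , len , earlier) = extend-by (continue c (row u earlier))
    where
    extend-by : ∃[ Δ' ] (Chain [] (Δ' ++ Δ) × length Δ' ≤ row-cost n m s × T u ∈ (Δ' ++ Δ) ++ []) →
                Rows (suc (toℕ u))
    extend-by (Δ' , c' , len' , Tu∈) = Δ' ++ Δ , c' , stack Δ' Δ len' len , up-to-u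
      where
      up-to-u : ∀ v → toℕ v < suc (toℕ u) → T v ∈ (Δ' ++ Δ) ++ []
      up-to-u v v≤u with m<1+n⇒m<n∨m≡n v≤u
      ... | inj₁ v<u = reassoc Δ' (xs⊆ys++xs _ Δ' (earlier v v<u))
      ... | inj₂ v≡u = subst (λ w → T w ∈ (Δ' ++ Δ) ++ []) (sym (toℕ-injective v≡u)) Tu∈

  rows : ∀ k → k ≤ s → Rows k
  rows zero    _   = [] , [] , z≤n , λ _ ()
  rows (suc k) k<s = add-row (fromℕ< k<s) (toℕ-fromℕ< k<s) (rows k (<⇒≤ k<s))

  refutation : ∀ u → suc (toℕ u) ≡ s →
               ∃[ k ] (Refutation (RREF F s) k × suc k ≤ final-cost n + s * row-cost n m s)
  refutation u last = from-rows (rows s ≤-refl)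
    where
    from-rows : Rows s → ∃[ k ] (Refutation (RREF F s) k × suc k ≤ final-cost n + s * row-cost n m s)
    from-rows (Δ , c , len , all-rows) =
      refutation-after c len (last-row u last (all-rows u (≤-reflexive last)))

lemma5p2 : ∃[ c ] (∀ (n m s : ℕ) → 1 ≤ n → 1 ≤ m → 1 ≤ s →
    (F : Fin m → Clause (Fin n)) → (∀ j → NonTaut (F j)) → Distinct F →
    Satisfiable F →
    ∃[ k ] (Refutation (RREF F s) k × suc k ≤ c * (s * n * m) ^ 2))
-- With a satisfying assignment α, the construction refutes RREF(F,s) through
-- its last row fromℕ s, within a length that total-bound turns into
-- 74 · (s·n·m)².
lemma5p2 = 74 , refute
  where
  refute : ∀ (n m s : ℕ) → 1 ≤ n → 1 ≤ m → 1 ≤ s →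
           (F : Fin m → Clause (Fin n)) → (∀ j → NonTaut (F j)) → Distinct F →
           Satisfiable F →
           ∃[ k ] (Refutation (RREF F s) k × suc k ≤ 74 * (s * n * m) ^ 2)
  refute n m (suc s) 1≤n 1≤m _ F _ _ (α , α⊨F) =
    within-bound (RREFRefutation.refutation F α α⊨F (fromℕ s) (cong suc (toℕ-fromℕ s)))
    where
    instance
      _ = >-nonZero 1≤n
      _ = >-nonZero 1≤m
    within-bound : ∃[ k ] (Refutation (RREF F (suc s)) k × suc k ≤ final-cost n + suc s * row-cost n m (suc s)) →
                   ∃[ k ] (Refutation (RREF F (suc s)) k × suc k ≤ 74 * (suc s * n * m) ^ 2)
    within-bound (k , refutes , short) = k , refutes , ≤-trans short (total-bound n m (suc s))
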